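{- Let $p \geq 1$ be an integer, $c = 2p+1$, and let $n \geq m \geq 0$ be integers. Then $r(S_c(n,m)) \geq 2(n+m+p)-1$.
   Context: For integers $n \geq m \geq 0$ and $c \geq 1$, the linked double star $S_c(n,m)$ is the graph on vertices $a_1,\dots,a_c, v_1,\dots,v_n, w_1,\dots,w_m$ with edges $a_1v_i$ ($1\le i\le n$), $a_ja_{j+1}$ ($1 \le j \le c-1$) and $a_cw_j$ ($1\le j\le m$). The ramsey number $r(G)$ is the least integer $r$ such that every 2-coloring of the edges of $K_r$ contains a monochromatic copy of $G$. -}

module Defs where

open import Data.Nat using (ℕ; suc)
open import Data.Fin using (Fin; toℕ)
open import Data.Bool using (Bool)
open import Data.Product using (Σ; _×_)
open import Relation.Binary.PropositionalEquality using (_≡_)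
open import Function.Definitions using (Injective)

-- A (simple, undirected) graph given by a vertex type and an edge relation.
-- Edges are read as unordered pairs: an edge x y means {x,y}.
record Graph : Set₁ where
  field
    V : Set
    E : V → V → Set
open Graph public

-- Vertices of the linked double star S_c(n,m):
-- a_1..a_c  (a h, h : Fin c, a_i = a (i-1)), v_1..v_n, w_1..w_m.
data SVertex (c n m : ℕ) : Set where
  a : Fin c → SVertex c n m
  v : Fin n → SVertex c n m
  w : Fin m → SVertex c n m

data SEdge (c n m : ℕ) : SVertex c n m → SVertex c n m → Set where
  av : (h : Fin c) → toℕ h ≡ 0 → (i : Fin n) → SEdge c n m (a h) (v i)
  aa : (j j' : Fin c) → suc (toℕ j) ≡ toℕ j' → SEdge c n m (a j) (a j')
  aw : (h : Fin c) → suc (toℕ h) ≡ c → (j : Fin m) → SEdge c n m (a h) (w j)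

S : ℕ → ℕ → ℕ → Graph
S c n m = record { V = SVertex c n m ; E = SEdge c n m }

-- A 2-colouring of the edges of K_r: a symmetric colour function on pairs
-- of vertices (values on the diagonal are irrelevant).
Symmetric : {r : ℕ} → (Fin r → Fin r → Bool) → Set
Symmetric {r} χ = (i j : Fin r) → χ i j ≡ χ j i

MonoCopy : (G : Graph) → {r : ℕ} → (Fin r → Fin r → Bool) → Bool → Set
MonoCopy G {r} χ col =
  Σ (V G → Fin r) λ f →
    Injective _≡_ _≡_ f × ((x y : V G) → E G x y → χ (f x) (f y) ≡ col)

RamseyFor : Graph → ℕ → Set
RamseyFor G r =
  (χ : Fin r → Fin r → Bool) → Symmetric χ → Σ Bool λ col → MonoCopy G χ col

-- "r(G) ≥ N": every r with the Ramsey property for G is at least N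
-- (r(G) is the least such r).
RamseyAtLeast : Graph → ℕ → Set
RamseyAtLeast G N = (r : ℕ) → RamseyFor G r → N Data.Nat.≤ r

module Submission where

-- Split the vertices of K_{2K} into two halves of size K, colour edges inside a half
-- red and edges between the halves blue.  A monochromatic homomorphic image of
-- S_c(n,m) then changes halves along each of its edges either never or always, so
-- the vertices at odd distance from a_1 all land in one half.  When c = 2p + 1
-- these are v_1, …, v_n, w_1, …, w_m and a_2, a_4, …, a_{2p}, hence n + m + p ≤ K.
-- Taking K = ⌈r/2⌉ gives r ≥ 2(n + m + p) − 1.

open import Defs
open import Data.Bool using (Bool; false; true; _xor_)
open import Data.Bool.Properties using (xor-assoc; xor-comm; xor-same; xor-identityʳ)
open import Data.Fin using (Fin; zero; toℕ; fromℕ<; inject≤; splitAt)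
open import Data.Fin.Properties
  using (toℕ-fromℕ<; toℕ<n; toℕ-injective; fromℕ<-cong; inject≤-injective; injective⇒≤; +↔⊎)
open import Data.Nat using (ℕ; zero; suc; _+_; _*_; _∸_; _≤_; _<_; z≤n; s≤s; ⌈_/2⌉)
open import Data.Nat.Properties
open import Data.Product using (Σ; _,_)
open import Data.Sum using (_⊎_; inj₁; inj₂; [_,_]′; reduce)
open import Data.Sum.Function.Propositional using (_⊎-↔_)
open import Function using (_∘_; const; _↔_; _↣_; Injection)
open import Function.Definitions using (Injective)
open import Function.Properties.Inverse using (↔-refl; ↔-trans; ↔⇒↣)
open import Relation.Binary.PropositionalEquality

RamseyFor-mono : ∀ {G r r′} → r ≤ r′ → RamseyFor G r → RamseyFor G r′
RamseyFor-mono r≤r′ ramsey χ χ-sym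
  with ramsey (λ i j → χ (inject≤ i r≤r′) (inject≤ j r≤r′)) (λ i j → χ-sym _ _)
... | col , f , f-injective , f-mono =
  col , (λ x → inject≤ (f x) r≤r′) , f-injective ∘ inject≤-injective _ _ _ _ , f-mono

xor-cancelʳ : ∀ x y → (x xor y) xor y ≡ x
xor-cancelʳ x y = begin
  (x xor y) xor y ≡⟨ xor-assoc x y y ⟩
  x xor (y xor y) ≡⟨ cong (x xor_) (xor-same y) ⟩
  x xor false     ≡⟨ xor-identityʳ x ⟩
  x               ∎
  where open ≡-Reasoning

xor-solveʳ : ∀ {x y z} → x xor y ≡ z → y ≡ x xor z
xor-solveʳ {x} {y} refl = begin
  y               ≡⟨ cong (_xor y) (sym (xor-same x)) ⟩
  (x xor x) xor y ≡⟨ xor-assoc x x y ⟩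
  x xor (x xor y) ∎
  where open ≡-Reasoning

isInj₂ : {A : Set} → A ⊎ A → Bool
isInj₂ = [ const false , const true ]′

isInj₂-reduce-injective : {A : Set} (s t : A ⊎ A) → isInj₂ s ≡ isInj₂ t → reduce s ≡ reduce t → s ≡ t
isInj₂-reduce-injective (inj₁ x) (inj₁ .x) _ refl = refl
isInj₂-reduce-injective (inj₂ x) (inj₂ .x) _ refl = refl
isInj₂-reduce-injective (inj₁ _) (inj₂ _) () _
isInj₂-reduce-injective (inj₂ _) (inj₁ _) () _

module Halves (K : ℕ) where

  side : Fin (K + K) → Bool
  side = isInj₂ ∘ splitAt K

  position : Fin (K + K) → Fin K
  position = reduce ∘ splitAt K

  side-position-injective : ∀ {i j} → side i ≡ side j → position i ≡ position j → i ≡ j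
  side-position-injective {i} {j} same-side same-position =
    Injection.injective (↔⇒↣ +↔⊎)
      (isInj₂-reduce-injective (splitAt K i) (splitAt K j) same-side same-position)

  crossing : Fin (K + K) → Fin (K + K) → Bool
  crossing i j = side i xor side j

  crossing-sym : Symmetric crossing
  crossing-sym i j = xor-comm (side i) (side j)

-- The vertices of S_{2p+1}(n,m) at odd distance from a_1; a_{2k+2} has index 2k + 1.
OddVertex : ℕ → ℕ → ℕ → Set
OddVertex p n m = (Fin n ⊎ Fin m) ⊎ Fin p

odd<c : ∀ {p} (k : Fin p) → suc (2 * toℕ k) < suc (2 * p)
odd<c k = s≤s (*-monoʳ-< 2 (toℕ<n k))

oddVertex : ∀ {p n m} → OddVertex p n m → SVertex (suc (2 * p)) n m
oddVertex (inj₁ (inj₁ i)) = v i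
oddVertex (inj₁ (inj₂ j)) = w j
oddVertex (inj₂ k)        = a (fromℕ< (odd<c k))

a-injective : ∀ {c n m} {h h′ : Fin c} → a {c} {n} {m} h ≡ a h′ → h ≡ h′
a-injective refl = refl

oddVertex-injective : ∀ {p n m} → Injective _≡_ _≡_ (oddVertex {p} {n} {m})
oddVertex-injective {x = inj₁ (inj₁ i)} {inj₁ (inj₁ .i)} refl = refl
oddVertex-injective {x = inj₁ (inj₂ j)} {inj₁ (inj₂ .j)} refl = refl
oddVertex-injective {x = inj₂ k} {inj₂ k′} eq = cong inj₂ (toℕ-injective (*-cancelˡ-≡ _ _ 2 (suc-injective
  (trans (sym (toℕ-fromℕ< (odd<c k))) (trans (cong toℕ (a-injective eq)) (toℕ-fromℕ< (odd<c k′)))))))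
oddVertex-injective {x = inj₁ (inj₁ _)} {inj₁ (inj₂ _)} ()
oddVertex-injective {x = inj₁ (inj₁ _)} {inj₂ _} ()
oddVertex-injective {x = inj₁ (inj₂ _)} {inj₁ (inj₁ _)} ()
oddVertex-injective {x = inj₁ (inj₂ _)} {inj₂ _} ()
oddVertex-injective {x = inj₂ _} {inj₁ (inj₁ _)} ()
oddVertex-injective {x = inj₂ _} {inj₁ (inj₂ _)} ()

enumerate-OddVertex : ∀ {p n m} → Fin (n + m + p) ↔ OddVertex p n m
enumerate-OddVertex = ↔-trans +↔⊎ (+↔⊎ ⊎-↔ ↔-refl)

module Parity {p n m : ℕ} (σ : SVertex (suc (2 * p)) n m → Bool) (col : Bool)
              (σ-shift : ∀ {x y} → SEdge (suc (2 * p)) n m x y → σ y ≡ σ x xor col) where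

  σ-step : ∀ k (k+1<c : suc k < suc (2 * p)) →
           σ (a (fromℕ< k+1<c)) ≡ σ (a (fromℕ< (<-trans (n<1+n k) k+1<c))) xor col
  σ-step k k+1<c = σ-shift (aa _ _ (trans (cong suc (toℕ-fromℕ< _)) (sym (toℕ-fromℕ< k+1<c))))

  σ-even : ∀ j (2j<c : 2 * j < suc (2 * p)) → σ (a (fromℕ< 2j<c)) ≡ σ (a zero)
  σ-even zero    _   = refl
  σ-even (suc j) 2j<c = begin
    σ (a (fromℕ< 2j<c))                  ≡⟨ cong (σ ∘ a) (fromℕ<-cong _ _ (*-suc 2 j) 2j<c 2j+2<c) ⟩
    σ (a (fromℕ< 2j+2<c))                ≡⟨ σ-step (suc (2 * j)) 2j+2<c ⟩
    σ (a (fromℕ< 2j+1<c)) xor col        ≡⟨ cong (_xor col) (σ-step (2 * j) 2j+1<c) ⟩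
    (σ (a (fromℕ< 2j<c′)) xor col) xor col ≡⟨ xor-cancelʳ _ col ⟩
    σ (a (fromℕ< 2j<c′))                 ≡⟨ σ-even j 2j<c′ ⟩
    σ (a zero)                           ∎
    where
      open ≡-Reasoning
      2j+2<c : suc (suc (2 * j)) < suc (2 * p)
      2j+2<c = subst (_< suc (2 * p)) (*-suc 2 j) 2j<c
      2j+1<c : suc (2 * j) < suc (2 * p)
      2j+1<c = <-trans (n<1+n _) 2j+2<c
      2j<c′ : 2 * j < suc (2 * p)
      2j<c′ = <-trans (n<1+n _) 2j+1<c

  σ-oddVertex : ∀ u → σ (oddVertex {p} u) ≡ σ (a zero) xor col
  σ-oddVertex (inj₁ (inj₁ i)) = σ-shift (av zero refl i)
  σ-oddVertex (inj₁ (inj₂ j)) =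
    trans (σ-shift (aw _ (cong suc (toℕ-fromℕ< 2p<c)) j)) (cong (_xor col) (σ-even p 2p<c))
    where
      2p<c : 2 * p < suc (2 * p)
      2p<c = n<1+n (2 * p)
  σ-oddVertex (inj₂ k) =
    trans (σ-step (2 * toℕ k) (odd<c k)) (cong (_xor col) (σ-even (toℕ k) (<-trans (n<1+n _) (odd<c k))))

RamseyFor-S⇒≤ : ∀ p n m K → RamseyFor (S (suc (2 * p)) n m) (K + K) → n + m + p ≤ K
RamseyFor-S⇒≤ p n m K ramsey = count (ramsey crossing crossing-sym)
  where
    open Halves K

    count : Σ Bool (MonoCopy (S (suc (2 * p)) n m) crossing) → n + m + p ≤ K
    count (col , f , f-injective , f-mono) =
      injective⇒≤ {f = position ∘ f ∘ oddVertex {p} ∘ Injection.to enumerate} λ eq →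
        Injection.injective enumerate (oddVertex-injective (f-injective
          (side-position-injective (trans (σ-oddVertex _) (sym (σ-oddVertex _))) eq)))
      where
        open Parity {p} (side ∘ f) col (λ {x} {y} edge → xor-solveʳ {side (f x)} (f-mono x y edge))
        enumerate : Fin (n + m + p) ↣ OddVertex p n m
        enumerate = ↔⇒↣ enumerate-OddVertex

n≤⌈n/2⌉+⌈n/2⌉ : ∀ n → n ≤ ⌈ n /2⌉ + ⌈ n /2⌉
n≤⌈n/2⌉+⌈n/2⌉ n = subst (_≤ ⌈ n /2⌉ + ⌈ n /2⌉) (⌊n/2⌋+⌈n/2⌉≡n n) (+-monoˡ-≤ ⌈ n /2⌉ (⌊n/2⌋≤⌈n/2⌉ n))

2*⌈n/2⌉≤1+n : ∀ n → 2 * ⌈ n /2⌉ ≤ suc n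
2*⌈n/2⌉≤1+n zero          = z≤n
2*⌈n/2⌉≤1+n (suc zero)    = ≤-refl
2*⌈n/2⌉≤1+n (suc (suc n)) rewrite *-suc 2 ⌈ n /2⌉ = s≤s (s≤s (2*⌈n/2⌉≤1+n n))

lemma2p2 : (p n m : ℕ) → 1 ≤ p → m ≤ n →
    RamseyAtLeast (S (2 * p + 1) n m) (2 * (n + m + p) ∸ 1)
lemma2p2 p n m _ _ r ramsey = ∸-monoˡ-≤ 1 (≤-trans (*-monoʳ-≤ 2 n+m+p≤⌈r/2⌉) (2*⌈n/2⌉≤1+n r))
  where
    ramsey′ : RamseyFor (S (suc (2 * p)) n m) r
    ramsey′ = subst (λ c → RamseyFor (S c n m) r) (+-comm (2 * p) 1) ramsey
    n+m+p≤⌈r/2⌉ : n + m + p ≤ ⌈ r /2⌉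
    n+m+p≤⌈r/2⌉ = RamseyFor-S⇒≤ p n m ⌈ r /2⌉ (RamseyFor-mono (n≤⌈n/2⌉+⌈n/2⌉ r) ramsey′)
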